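{- Let $\sigma\colon A^*\to A^*$ be a morphism prolongable on $a\in A$ and let $\mathbf{x}=\sigma^{\omega}(a)=x_0x_1\cdots$. Suppose that $\sigma$ is recognizable on $\mathbf{x}$ with a computable recognizability constant $C$ and that $\mathbf{x}$ is $k$-automatic. Then the cutting set $\mathsf{CS}_{\sigma,a}=\{|\sigma(\mathrm{pref}_n(\mathbf{x}))|\colon n\ge0\}$ is $k$-definable.
   Context: $\sigma$ is prolongable on $a$ if $\sigma(a)=au$ and $|\sigma^n(a)|\to\infty$; $\sigma^{\omega}(a)=\lim_n\sigma^n(a)$. $\mathrm{pref}_n(\mathbf{x})$ is the length-$n$ prefix of $\mathbf{x}$, and $\mathbf{x}[i,j]=x_i\cdots x_j$. Write $p_i=|\sigma(x_0\cdots x_{i-1})|$. $\sigma$ is recognizable on $\mathbf{x}$ if there is a constant $C>0$ such that for all $n\ge0$ and all $i$ with $p_i\ge C$: if $\mathbf{x}[n-C,n+C]=\mathbf{x}[p_i-C,p_i+C]$, then there exists $j$ with $n=p_j$ and $x_i=x_j$; the least such $C$ is the constant of recognizability of $\sigma$ on $\mathbf{x}$. An infinite word is $k$-automatic if some deterministic finite automaton with output reading the base-$k$ representation of $n$ outputs its $n$-th letter. A set $E\subseteq\mathbb{N}$ is $k$-definable if it is first-order definable in $\langle\mathbb{N},+,V_k\rangle$ ($V_k(n)$ the largest power of $k$ dividing $n$), equivalently the base-$k$ representations of its elements form a regular language. -}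

module Defs where

open import Data.Nat using (ℕ; zero; suc; _+_; _*_; _∸_; _<_; _≤_; NonZero)
open import Data.Nat.DivMod using (_/_; _mod_)
open import Data.Fin using (Fin; fromℕ<)
open import Data.List using (List; []; _∷_; [_]; length; concatMap; map; upTo; reverse; foldl; lookup)
open import Data.Bool using (Bool; true)
open import Data.Product using (Σ; ∃; _×_)
open import Relation.Binary.PropositionalEquality using (_≡_)

Morphism : ℕ → Set
Morphism m = Fin m → List (Fin m)

applyM : ∀ {m} → Morphism m → List (Fin m) → List (Fin m)
applyM σ w = concatMap σ w

iterM : ∀ {m} → Morphism m → ℕ → List (Fin m) → List (Fin m)
iterM σ zero    w = w
iterM σ (suc n) w = applyM σ (iterM σ n w)

Prolongable : ∀ {m} → Morphism m → Fin m → Set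
Prolongable σ a =
  (∃ λ u → σ a ≡ (a ∷ u)) × (∀ N → ∃ λ n → N ≤ length (iterM σ n [ a ]))

-- x = σ^ω(a): every σ^n(a) is a prefix of the infinite word x (together with
-- prolongability this determines x uniquely).
IsFixedPointFrom : ∀ {m} → Morphism m → Fin m → (ℕ → Fin m) → Set
IsFixedPointFrom σ a x =
  ∀ n i (h : i < length (iterM σ n [ a ])) → lookup (iterM σ n [ a ]) (fromℕ< h) ≡ x i

pref : ∀ {m} → (ℕ → Fin m) → ℕ → List (Fin m)
pref x n = map x (upTo n)

cut : ∀ {m} → Morphism m → (ℕ → Fin m) → ℕ → ℕ
cut σ x i = length (applyM σ (pref x i))

-- σ is recognizable on x with constant C (windows x[n-C,n+C], only meaningful for n ≥ C).
RecognizableWith : ∀ {m} → Morphism m → (ℕ → Fin m) → ℕ → Set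
RecognizableWith σ x C =
  (0 < C) ×
  (∀ n i → C ≤ cut σ x i → C ≤ n →
    (∀ t → t ≤ 2 * C → x (n ∸ C + t) ≡ x (cut σ x i ∸ C + t)) →
    ∃ λ j → (n ≡ cut σ x j) × (x i ≡ x j))

-- Base-k digits, least significant first, with fuel (fuel n suffices for k ≥ 2).
lsdDigits : (k : ℕ) .{{_ : NonZero k}} → ℕ → ℕ → List (Fin k)
lsdDigits k zero       n       = []
lsdDigits k (suc fuel) zero    = []
lsdDigits k (suc fuel) (suc n) = (suc n mod k) ∷ lsdDigits k fuel (suc n / k)

-- Canonical base-k representation, most significant digit first, no leading
-- zeros; the representation of 0 is the empty word.
rep : (k : ℕ) .{{_ : NonZero k}} → ℕ → List (Fin k)
rep k n = reverse (lsdDigits k n n)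

record DFAO (k : ℕ) (B : Set) : Set where
  field
    nStates : ℕ
    start   : Fin nStates
    δ       : Fin nStates → Fin k → Fin nStates
    out     : Fin nStates → B

run : ∀ {k B} → DFAO k B → List (Fin k) → B
run M w = DFAO.out M (foldl (DFAO.δ M) (DFAO.start M) w)

Automatic : ∀ {m} (k : ℕ) .{{_ : NonZero k}} → (ℕ → Fin m) → Set
Automatic k x = Σ (DFAO k _) λ M → ∀ n → run M (rep k n) ≡ x n

-- E ⊆ ℕ is k-definable: the base-k representations of its elements form a
-- regular language, i.e. a DFA (output Bool = accept) recognises them.
Definable : (k : ℕ) .{{_ : NonZero k}} → (ℕ → Set) → Set
Definable k E = Σ (DFAO k Bool) λ M → ∀ n → (E n → run M (rep k n) ≡ true) × (run M (rep k n) ≡ true → E n)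

CuttingSet : ∀ {m} → Morphism m → (ℕ → Fin m) → ℕ → Set
CuttingSet σ x N = ∃ λ n → cut σ x n ≡ N

{-# OPTIONS --safe #-}
module Submission where

-- Recognizability makes membership of a position n ≥ C in the cutting set a property of
-- its window x[n-C, n+C]: n is a cutting point iff that window also surrounds some cutting
-- point ≥ C. Whether a window w does is decidable: if w occurs at any position n ≥ C, an
-- automaton for the windows finds such an n (pumping gives one below k^|states|), and then
-- w surrounds a cutting point iff n is one, which is decidable as the cutting points
-- |σ(pref_i x)| are nondecreasing and unbounded in i. So the cutting set is the preimage
-- of a decidable set under n ↦ (min(n, C), x[n-C, n+C]), which is k-automatic because
-- automatic sequences are closed under n ↦ n ± 1 and tupling; such preimages are definable.

open import Defs
open import Data.Bool using (Bool; true; false)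
open import Data.Empty using (⊥-elim)
open import Data.Fin using (Fin; toℕ; fromℕ; fromℕ<; inject₁; combine; remQuot)
  renaming (zero to fzero; suc to fsuc)
open import Data.Fin.Properties
  using (toℕ-fromℕ; toℕ-fromℕ<; toℕ-inject₁; toℕ-injective; toℕ<n; remQuot-combine; pigeonhole; any?)
  renaming (_≟_ to _≟ᶠ_)
open import Data.List
  using (List; []; _∷_; [_]; _++_; length; map; upTo; applyUpTo; reverse; foldl; lookup)
open import Data.List.Properties
  using (++-identityʳ; foldl-++; unfold-reverse; length-++; length-++-≤ˡ; concatMap-++; applyUpTo-∷ʳ; map-upTo)
open import Data.Nat
  using (ℕ; zero; suc; pred; _+_; _*_; _∸_; _^_; _⊓_; _≡ᵇ_; _<_; _≤_; z≤n; s≤s; s≤s⁻¹; NonZero; >-nonZero; _<?_; _≤?_; _≟_)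
open import Data.Nat.Properties
open import Data.Nat.DivMod
open import Data.Nat.Divisibility using (divides-refl)
open import Data.Nat.Induction using (<-rec)
open import Data.Nat.Tactic.RingSolver using (solve-∀)
open import Data.Product as Product using (Σ; ∃; _×_; _,_; proj₁; proj₂; uncurry)
open import Data.Sum using (_⊎_; inj₁; inj₂)
open import Data.Vec as Vec using (Vec; tabulate)
open import Data.Vec.Properties using (≡-dec; lookup∘tabulate)
open import Function using (_∘_; id)
open import Function.Bundles using (_⇔_; mk⇔; Equivalence)
open import Relation.Binary.Core using (_Preserves_⟶_)
open import Relation.Binary.PropositionalEquality
  using (_≡_; _≗_; refl; sym; trans; cong; cong₂; subst; module ≡-Reasoning)
open import Relation.Nullary using (Dec; yes; no; does)
open import Relation.Nullary.Decidable as Dec using (_×-dec_; _⊎-dec_; dec-true)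
open import Relation.Unary using (Decidable)

open Equivalence using (to; from)

dec-true⁻¹ : {A : Set} (a? : Dec A) → does a? ≡ true → A
dec-true⁻¹ (yes a) _ = a

image? : {f : ℕ → ℕ} → f Preserves _≤_ ⟶ _≤_ → (∀ N → ∃ λ j → N ≤ f j) →
         ∀ n → Dec (∃ λ i → f i ≡ n)
image? {f} mono unbounded n with j , n<fj ← unbounded (suc n) =
  Dec.map′ (λ (i , fi≡n) → toℕ i , fi≡n) below-j (any? (λ (i : Fin j) → f (toℕ i) ≟ n))
  where
  below-j : (∃ λ i → f i ≡ n) → ∃ λ (i : Fin j) → f (toℕ i) ≡ n
  below-j (i , fi≡n) with i <? j
  ... | yes i<j = fromℕ< i<j , trans (cong f (toℕ-fromℕ< i<j)) fi≡n
  ... | no i≮j  = ⊥-elim (<⇒≱ n<fj (subst (f j ≤_) fi≡n (mono (≮⇒≥ i≮j))))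

record Finite (Q : Set) : Set where
  field
    size          : ℕ
    encode        : Q → Fin size
    decode        : Fin size → Q
    decode∘encode : ∀ q → decode (encode q) ≡ q

finite-Fin : ∀ n → Finite (Fin n)
finite-Fin n = record { size = n ; encode = id ; decode = id ; decode∘encode = λ _ → refl }

finite-Bool : Finite Bool
finite-Bool = record { size = 2 ; encode = encode ; decode = decode ; decode∘encode = decode∘encode }
  where
  encode : Bool → Fin 2
  encode false = fzero
  encode true  = fsuc fzero
  decode : Fin 2 → Bool
  decode fzero    = false
  decode (fsuc _) = true
  decode∘encode : ∀ b → decode (encode b) ≡ b
  decode∘encode false = refl
  decode∘encode true  = refl

finite-× : ∀ {A B} → Finite A → Finite B → Finite (A × B)
finite-× {A} {B} FA FB = record
  { size = FA.size * FB.size ; encode = encode ; decode = decode ; decode∘encode = decode∘encode }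
  where
  module FA = Finite FA
  module FB = Finite FB
  encode : A × B → Fin (FA.size * FB.size)
  encode (a , b) = combine (FA.encode a) (FB.encode b)
  decode : Fin (FA.size * FB.size) → A × B
  decode i = Product.map FA.decode FB.decode (remQuot {FA.size} FB.size i)
  decode∘encode : ∀ p → decode (encode p) ≡ p
  decode∘encode (a , b) = trans (cong (Product.map FA.decode FB.decode) (remQuot-combine (FA.encode a) (FB.encode b)))
                                (cong₂ _,_ (FA.decode∘encode a) (FB.decode∘encode b))

module _ {m} (σ : Morphism m) (x : ℕ → Fin m) where

  pref-suc : ∀ j → pref x (suc j) ≡ pref x j ++ [ x j ]
  pref-suc j = begin
    map x (upTo (suc j))        ≡⟨ map-upTo x (suc j) ⟩
    applyUpTo x (suc j)         ≡⟨ applyUpTo-∷ʳ x j ⟨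
    applyUpTo x j ++ [ x j ]    ≡⟨ cong (_++ [ x j ]) (map-upTo x j) ⟨
    pref x j ++ [ x j ]         ∎
    where open ≡-Reasoning

  cut-suc : ∀ j → cut σ x (suc j) ≡ cut σ x j + length (σ (x j))
  cut-suc j = begin
    length (applyM σ (pref x (suc j)))                ≡⟨ cong (length ∘ applyM σ) (pref-suc j) ⟩
    length (applyM σ (pref x j ++ [ x j ]))           ≡⟨ cong length (concatMap-++ σ (pref x j) [ x j ]) ⟩
    length (applyM σ (pref x j) ++ (σ (x j) ++ []))   ≡⟨ length-++ (applyM σ (pref x j)) ⟩
    cut σ x j + length (σ (x j) ++ [])                ≡⟨ cong (λ w → cut σ x j + length w) (++-identityʳ (σ (x j))) ⟩
    cut σ x j + length (σ (x j))                      ∎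
    where open ≡-Reasoning

  cut-mono : ∀ {i j} → i ≤ j → cut σ x i ≤ cut σ x j
  cut-mono {j = zero}  z≤n   = ≤-refl
  cut-mono {j = suc j} i≤1+j with m≤n⇒m<n∨m≡n i≤1+j
  ... | inj₂ refl  = ≤-refl
  ... | inj₁ i<1+j =
    ≤-trans (cut-mono (s≤s⁻¹ i<1+j)) (≤-trans (m≤m+n _ _) (≤-reflexive (sym (cut-suc j))))

applyUpTo-lookup : ∀ {m} (w : List (Fin m)) (y : ℕ → Fin m) →
                   (∀ i (i<∣w∣ : i < length w) → lookup w (fromℕ< i<∣w∣) ≡ y i) →
                   applyUpTo y (length w) ≡ w
applyUpTo-lookup []      y agree = refl
applyUpTo-lookup (z ∷ w) y agree =
  cong₂ _∷_ (sym (agree 0 (s≤s z≤n))) (applyUpTo-lookup w (y ∘ suc) (λ i → agree (suc i) ∘ s≤s))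

module _ {m} {σ : Morphism m} {a : Fin m} {x : ℕ → Fin m}
         (prolongable : Prolongable σ a) (fixed : IsFixedPointFrom σ a x) where

  private
    iterate : ℕ → List (Fin m)
    iterate t = iterM σ t [ a ]

  iterate-extends : ∀ t → ∃ λ s → iterate (suc t) ≡ iterate t ++ s
  iterate-extends zero with u , σa≡au ← proj₁ prolongable = u , trans (++-identityʳ (σ a)) σa≡au
  iterate-extends (suc t) with s , extends ← iterate-extends t =
    applyM σ s , trans (cong (applyM σ) extends) (concatMap-++ σ (iterate t) s)

  pref-iterate : ∀ t → pref x (length (iterate t)) ≡ iterate t
  pref-iterate t = trans (map-upTo x (length (iterate t))) (applyUpTo-lookup (iterate t) x (fixed t))

  length-iterate≤cut : ∀ t → length (iterate t) ≤ cut σ x (length (iterate t))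
  length-iterate≤cut t with s , extends ← iterate-extends t = begin
    length (iterate t)                ≤⟨ length-++-≤ˡ (iterate t) ⟩
    length (iterate t ++ s)           ≡⟨ cong length extends ⟨
    length (iterate (suc t))          ≡⟨ cong (length ∘ applyM σ) (pref-iterate t) ⟨
    cut σ x (length (iterate t))      ∎
    where open ≤-Reasoning

  cut-unbounded : ∀ N → ∃ λ j → N ≤ cut σ x j
  cut-unbounded N with t , N≤∣σᵗa∣ ← proj₂ prolongable N =
    length (iterate t) , ≤-trans N≤∣σᵗa∣ (length-iterate≤cut t)

  cuttingSet? : ∀ n → Dec (CuttingSet σ x n)
  cuttingSet? = image? (cut-mono σ x) cut-unbounded

module _ (k′ : ℕ) where

  private
    k : ℕ
    k = suc (suc k′)

    1<k : 1 < k
    1<k = s≤s (s≤s z≤n)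

  digit : ℕ → Fin k
  digit n = n mod k

  toℕ-digit : ∀ n → toℕ (digit n) ≡ n % k
  toℕ-digit n = toℕ-fromℕ< (m%n<n n k)

  digit-expansion : ∀ n → toℕ (digit n) + (n / k) * k ≡ n
  digit-expansion n = trans (cong (_+ (n / k) * k) (toℕ-digit n)) (sym (m≡m%n+[m/n]*n n k))

  [d+v*k]/k≡v : ∀ (d : Fin k) v → (toℕ d + v * k) / k ≡ v
  [d+v*k]/k≡v d v = begin
    (toℕ d + v * k) / k     ≡⟨ +-distrib-/-∣ʳ (toℕ d) (divides-refl v) ⟩
    toℕ d / k + v * k / k   ≡⟨ cong₂ _+_ (m<n⇒m/n≡0 (toℕ<n d)) (m*n/n≡m v k) ⟩
    v                       ∎
    where open ≡-Reasoning

  digit[d+v*k]≡d : ∀ (d : Fin k) v → digit (toℕ d + v * k) ≡ d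
  digit[d+v*k]≡d d v = toℕ-injective (begin
    toℕ (digit (toℕ d + v * k))   ≡⟨ toℕ-digit (toℕ d + v * k) ⟩
    (toℕ d + v * k) % k           ≡⟨ [m+kn]%n≡m%n (toℕ d) v k ⟩
    toℕ d % k                     ≡⟨ m<n⇒m%n≡m (toℕ<n d) ⟩
    toℕ d                         ∎)
    where open ≡-Reasoning

  lsdDigits-fuel : ∀ f g n → n ≤ f → n ≤ g → lsdDigits k f n ≡ lsdDigits k g n
  lsdDigits-fuel zero    zero    zero    _         _         = refl
  lsdDigits-fuel zero    (suc g) zero    _         _         = refl
  lsdDigits-fuel (suc f) zero    zero    _         _         = refl
  lsdDigits-fuel (suc f) (suc g) zero    _         _         = refl
  lsdDigits-fuel (suc f) (suc g) (suc n) (s≤s n≤f) (s≤s n≤g) =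
    cong (digit (suc n) ∷_) (lsdDigits-fuel f g (suc n / k) (≤-trans n/k≤n n≤f) (≤-trans n/k≤n n≤g))
    where
    n/k≤n : suc n / k ≤ n
    n/k≤n = s≤s⁻¹ (m/n<m (suc n) k 1<k)

  rep-suc : ∀ n → rep k (suc n) ≡ rep k (suc n / k) ++ [ digit (suc n) ]
  rep-suc n = begin
    reverse (digit (suc n) ∷ lsdDigits k n (suc n / k))
      ≡⟨ unfold-reverse (digit (suc n)) (lsdDigits k n (suc n / k)) ⟩
    reverse (lsdDigits k n (suc n / k)) ++ [ digit (suc n) ]
      ≡⟨ cong (λ ds → reverse ds ++ [ digit (suc n) ]) (lsdDigits-fuel n (suc n / k) (suc n / k) n/k≤n ≤-refl) ⟩
    rep k (suc n / k) ++ [ digit (suc n) ]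
      ∎
    where
    open ≡-Reasoning
    n/k≤n : suc n / k ≤ n
    n/k≤n = s≤s⁻¹ (m/n<m (suc n) k 1<k)

  module Reach {Q : Set} (start : Q) (step : Q → Fin k → Q) where

    reach : ℕ → Q
    reach n = foldl step start (rep k n)

    reach-suc : ∀ n → reach (suc n) ≡ step (reach (suc n / k)) (digit (suc n))
    reach-suc n = trans (cong (foldl step start) (rep-suc n)) (foldl-++ step start (rep k (suc n / k)) _)

    -- The positivity hypothesis excludes d = v = 0: the representation of 0 is empty.
    reach-digit : ∀ (d : Fin k) v → 0 < toℕ d + v * k → reach (toℕ d + v * k) ≡ step (reach v) d
    reach-digit d v pos = trans (reach-pos (toℕ d + v * k) pos)
                                (cong₂ (λ u e → step (reach u) e) ([d+v*k]/k≡v d v) (digit[d+v*k]≡d d v))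
      where
      reach-pos : ∀ n → 0 < n → reach n ≡ step (reach (n / k)) (digit n)
      reach-pos (suc n) _ = reach-suc n

    reach-unique : (inv : ℕ → Q) → inv 0 ≡ start →
                   (∀ d v → 0 < toℕ d + v * k → inv (toℕ d + v * k) ≡ step (inv v) d) →
                   ∀ n → reach n ≡ inv n
    reach-unique inv inv-0 inv-digit = <-rec (λ n → reach n ≡ inv n) go
      where
      go : ∀ n → (∀ {m} → m < n → reach m ≡ inv m) → reach n ≡ inv n
      go zero    _  = sym inv-0
      go (suc n) ih = begin
        reach (suc n)                              ≡⟨ reach-suc n ⟩
        step (reach (suc n / k)) (digit (suc n))   ≡⟨ cong (λ q → step q (digit (suc n))) (ih (m/n<m (suc n) k 1<k)) ⟩
        step (inv (suc n / k)) (digit (suc n))     ≡⟨ inv-digit (digit (suc n)) (suc n / k) pos ⟨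
        inv (toℕ (digit (suc n)) + (suc n / k) * k) ≡⟨ cong inv (digit-expansion (suc n)) ⟩
        inv (suc n)                                ∎
        where
        open ≡-Reasoning
        pos : 0 < toℕ (digit (suc n)) + (suc n / k) * k
        pos = subst (0 <_) (sym (digit-expansion (suc n))) (s≤s z≤n)

  record Automaton {B : Set} (f : ℕ → B) : Set₁ where
    field
      State  : Set
      finite : Finite State
      start  : State
      step   : State → Fin k → State
      out    : State → B
    open Reach start step public
    field
      generates : ∀ n → out (reach n) ≡ f n

  automaton-by-invariant : ∀ {B Q : Set} {f : ℕ → B} → Finite Q → (start : Q) (step : Q → Fin k → Q) (out : Q → B)
    (inv : ℕ → Q) → inv 0 ≡ start → (∀ d v → 0 < toℕ d + v * k → inv (toℕ d + v * k) ≡ step (inv v) d) →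
    (∀ n → out (inv n) ≡ f n) → Automaton f
  automaton-by-invariant finite start step out inv inv-0 inv-digit out-inv = record
    { State = _ ; finite = finite ; start = start ; step = step ; out = out
    ; generates = λ n → trans (cong out (reach-unique inv inv-0 inv-digit n)) (out-inv n) }
    where open Reach start step

  fromDFAO : ∀ {B} (M : DFAO k B) → Automaton (λ n → run M (rep k n))
  fromDFAO M = record
    { State = _ ; finite = finite-Fin _ ; start = start ; step = δ ; out = out ; generates = λ _ → refl }
    where open DFAO M

  automaton-resp-≗ : ∀ {B} {f g : ℕ → B} → f ≗ g → Automaton f → Automaton g
  automaton-resp-≗ f≗g A = record { Automaton A ; generates = λ n → trans (generates n) (f≗g n) }
    where open Automaton A

  automaton-map : ∀ {B C} {f : ℕ → B} (h : B → C) → Automaton f → Automaton (h ∘ f)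
  automaton-map h A = record { Automaton A ; out = h ∘ out ; generates = cong h ∘ generates }
    where open Automaton A

  automaton-const : ∀ {B} (b : B) → Automaton (λ _ → b)
  automaton-const b = record
    { State = Fin 1 ; finite = finite-Fin 1 ; start = fzero ; step = λ _ _ → fzero ; out = λ _ → b
    ; generates = λ _ → refl }

  automaton-pair : ∀ {B C} {f : ℕ → B} {g : ℕ → C} → Automaton f → Automaton g → Automaton (λ n → f n , g n)
  automaton-pair A B = automaton-by-invariant
    (finite-× A.finite B.finite) (A.start , B.start)
    (λ (p , q) d → A.step p d , B.step q d) (λ (p , q) → A.out p , B.out q)
    (λ n → A.reach n , B.reach n) refl
    (λ d v pos → cong₂ _,_ (A.reach-digit d v pos) (B.reach-digit d v pos))
    (λ n → cong₂ _,_ (A.generates n) (B.generates n))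
    where
    module A = Automaton A
    module B = Automaton B

  automaton-tabulate : ∀ {L B} {f : Fin L → ℕ → B} → (∀ i → Automaton (f i)) →
                       Automaton (λ n → tabulate (λ i → f i n))
  automaton-tabulate {zero}  A = automaton-const Vec.[]
  automaton-tabulate {suc L} A =
    automaton-map (uncurry Vec._∷_) (automaton-pair (A fzero) (automaton-tabulate (A ∘ fsuc)))

  -- For n = d + v * k, n + 1 is (d + 1) + v * k, or 0 + (v + 1) * k when d = k - 1.
  automaton-∘suc : ∀ {B} {f : ℕ → B} → Automaton f → Automaton (f ∘ suc)
  automaton-∘suc A = automaton-by-invariant
    (finite-× finite finite) (start , reach 1)
    (λ (p , q) d → step p d , carry p q d (suc (toℕ d) <? k)) (out ∘ proj₂)
    (λ n → reach n , reach (suc n)) refl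
    (λ d v pos → cong₂ _,_ (reach-digit d v pos) (carry-correct d v (suc (toℕ d) <? k)))
    (generates ∘ suc)
    where
    open Automaton A
    carry : State → State → (d : Fin k) → Dec (suc (toℕ d) < k) → State
    carry p q d (yes d+1<k) = step p (fromℕ< d+1<k)
    carry p q d (no _)      = step q fzero
    carry-correct : ∀ d v (d+1<k? : Dec (suc (toℕ d) < k)) →
                    reach (suc (toℕ d + v * k)) ≡ carry (reach v) (reach (suc v)) d d+1<k?
    carry-correct d v (yes d+1<k) =
      trans (cong (λ e → reach (e + v * k)) (sym (toℕ-fromℕ< d+1<k))) (reach-digit (fromℕ< d+1<k) v (s≤s z≤n))
    carry-correct d v (no d+1≮k) =
      trans (cong (λ e → reach (e + v * k)) (≤-antisym (toℕ<n d) (≮⇒≥ d+1≮k))) (reach-digit fzero (suc v) (s≤s z≤n))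

  -- For n = d + v * k > 0, n - 1 is (d - 1) + v * k, or (k - 1) + (v - 1) * k when d = 0;
  -- the flag n ≡ᵇ 0 detects n - 1 = 0, whose representation is empty.
  automaton-∘pred : ∀ {B} {f : ℕ → B} → Automaton f → Automaton (f ∘ pred)
  automaton-∘pred A = automaton-by-invariant
    (finite-× finite-Bool (finite-× finite finite)) (true , start , start)
    (λ (z , p , q) d → false , step p d , borrow z p q d) (out ∘ proj₂ ∘ proj₂)
    (λ n → (n ≡ᵇ 0) , reach n , reach (pred n)) refl
    (λ d v pos → cong₂ _,_ (positive d v pos) (cong₂ _,_ (reach-digit d v pos) (borrow-correct d v pos)))
    (generates ∘ pred)
    where
    open Automaton A
    borrow : Bool → State → State → Fin k → State
    borrow _    _ q fzero        = step q (fromℕ (suc k′))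
    borrow true _ _ (fsuc fzero) = start
    borrow _    p _ (fsuc d)     = step p (inject₁ d)
    positive : ∀ (d : Fin k) v → 0 < toℕ d + v * k → (toℕ d + v * k ≡ᵇ 0) ≡ false
    positive d v pos with toℕ d + v * k
    ... | suc _ = refl
    reach-inject₁ : ∀ (d : Fin (suc k′)) v → 0 < toℕ d + v * k → reach (toℕ d + v * k) ≡ step (reach v) (inject₁ d)
    reach-inject₁ d v pos rewrite sym (toℕ-inject₁ d) = reach-digit (inject₁ d) v pos
    borrow-correct : ∀ d v → 0 < toℕ d + v * k →
                     reach (pred (toℕ d + v * k)) ≡ borrow (v ≡ᵇ 0) (reach v) (reach (pred v)) d
    borrow-correct fzero (suc v) _ =
      trans (cong (λ e → reach (e + v * k)) (sym (toℕ-fromℕ (suc k′)))) (reach-digit (fromℕ (suc k′)) v lastDigit>0)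
      where
      lastDigit>0 : 0 < toℕ (fromℕ (suc k′)) + v * k
      lastDigit>0 = subst (λ e → 0 < e + v * k) (sym (toℕ-fromℕ (suc k′))) (s≤s z≤n)
    borrow-correct (fsuc fzero)     zero    _ = refl
    borrow-correct (fsuc (fsuc d))  zero    _ = reach-inject₁ (fsuc d) zero (s≤s z≤n)
    borrow-correct (fsuc d)         (suc v) _ = reach-inject₁ d (suc v) (≤-trans (s≤s z≤n) (m≤n+m (suc v * k) (toℕ d)))

  [d+v*k]⊓C : ∀ d v C → (d + v * k) ⊓ C ≡ (d + (v ⊓ C) * k) ⊓ C
  [d+v*k]⊓C d v C with v ≤? C
  ... | yes v≤C rewrite m≤n⇒m⊓n≡m v≤C = refl
  ... | no  v≰C rewrite m≥n⇒m⊓n≡n (<⇒≤ (≰⇒> v≰C)) =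
    trans (m≥n⇒m⊓n≡n (C≤d+u*k v (<⇒≤ (≰⇒> v≰C)))) (sym (m≥n⇒m⊓n≡n (C≤d+u*k C ≤-refl)))
    where
    C≤d+u*k : ∀ u → C ≤ u → C ≤ d + u * k
    C≤d+u*k u C≤u = ≤-trans (≤-trans C≤u (m≤m*n u k)) (m≤n+m (u * k) d)

  automaton-⊓ : ∀ C → Automaton (_⊓ C)
  automaton-⊓ C = automaton-by-invariant
    (finite-Fin (suc C)) fzero (λ c d → capped (toℕ d + toℕ c * k)) toℕ
    capped refl
    (λ d v _ → toℕ-injective (begin
       toℕ (capped (toℕ d + v * k))                  ≡⟨ toℕ-capped _ ⟩
       (toℕ d + v * k) ⊓ C                           ≡⟨ [d+v*k]⊓C (toℕ d) v C ⟩
       (toℕ d + (v ⊓ C) * k) ⊓ C                     ≡⟨ cong (λ c → (toℕ d + c * k) ⊓ C) (toℕ-capped v) ⟨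
       (toℕ d + toℕ (capped v) * k) ⊓ C              ≡⟨ toℕ-capped _ ⟨
       toℕ (capped (toℕ d + toℕ (capped v) * k))     ∎))
    toℕ-capped
    where
    open ≡-Reasoning
    capped : ℕ → Fin (suc C)
    capped n = fromℕ< (s≤s (m⊓n≤n n C))
    toℕ-capped : ∀ n → toℕ (capped n) ≡ n ⊓ C
    toℕ-capped n = toℕ-fromℕ< (s≤s (m⊓n≤n n C))

  automaton-+ : ∀ {B} {f : ℕ → B} t → Automaton f → Automaton (λ n → f (t + n))
  automaton-+ zero    A = A
  automaton-+ (suc t) A = automaton-+ t (automaton-∘suc A)

  automaton-∸ : ∀ {B} {f : ℕ → B} c → Automaton f → Automaton (λ n → f (n ∸ c))
  automaton-∸         zero    A = A
  automaton-∸ {f = f} (suc c) A =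
    automaton-resp-≗ (λ n → cong f (pred[m∸n]≡m∸[1+n] n c)) (automaton-∸ c (automaton-∘pred A))

  module Pumping {B} {f : ℕ → B} (A : Automaton f) where
    open Automaton A
    open Finite finite

    reach-last-digit : ∀ r a i → 0 < a →
      reach (r + a * k ^ suc i) ≡ step (reach (r / k + a * k ^ i)) (digit r)
    reach-last-digit r a i a>0 = begin
      reach (r + a * k ^ suc i)                             ≡⟨ cong (λ e → reach (e + a * k ^ suc i)) (digit-expansion r) ⟨
      reach (toℕ (digit r) + r / k * k + a * k ^ suc i)     ≡⟨ cong reach (regroup (toℕ (digit r)) (r / k) a (k ^ i) k) ⟩
      reach (toℕ (digit r) + (r / k + a * k ^ i) * k)       ≡⟨ reach-digit (digit r) (r / k + a * k ^ i) pos ⟩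
      step (reach (r / k + a * k ^ i)) (digit r)            ∎
      where
      open ≡-Reasoning
      regroup : ∀ e q a K b → e + q * b + a * (b * K) ≡ e + (q + a * K) * b
      regroup = solve-∀
      pos : 0 < toℕ (digit r) + (r / k + a * k ^ i) * k
      pos = subst (0 <_) (regroup (toℕ (digit r)) (r / k) a (k ^ i) k)
              (≤-trans (*-mono-≤ a>0 (m^n>0 k (suc i))) (m≤n+m (a * k ^ suc i) _))

    -- rep (r + a * k ^ i) is rep a followed by the i digits of r, zero-padded.
    reach-append-digits : ∀ i {a b} r → 0 < a → 0 < b → reach a ≡ reach b → r < k ^ i →
                          reach (r + a * k ^ i) ≡ reach (r + b * k ^ i)
    reach-append-digits zero {a} {b} zero _ _ same _ =
      trans (cong reach (*-identityʳ a)) (trans same (cong reach (sym (*-identityʳ b))))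
    reach-append-digits zero (suc r) _ _ _ (s≤s ())
    reach-append-digits (suc i) {a} {b} r a>0 b>0 same r<kⁱ⁺¹ = begin
      reach (r + a * k ^ suc i)                   ≡⟨ reach-last-digit r a i a>0 ⟩
      step (reach (r / k + a * k ^ i)) (digit r)  ≡⟨ cong (λ q → step q (digit r)) (reach-append-digits i (r / k) a>0 b>0 same r/k<kⁱ) ⟩
      step (reach (r / k + b * k ^ i)) (digit r)  ≡⟨ reach-last-digit r b i b>0 ⟨
      reach (r + b * k ^ suc i)                   ∎
      where
      open ≡-Reasoning
      r/k<kⁱ : r / k < k ^ i
      r/k<kⁱ = m<n*o⇒m/o<n (subst (r <_) (*-comm k (k ^ i)) r<kⁱ⁺¹)

    -- The witness deletes the digits of n at positions I, …, J - 1.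
    reach-cut-digits : ∀ n {I J} .{{_ : NonZero (k ^ I)}} .{{_ : NonZero (k ^ J)}} → I < J → k ^ J ≤ n →
                       reach (n / k ^ I) ≡ reach (n / k ^ J) → ∃ λ n′ → n′ < n × reach n′ ≡ reach n
    reach-cut-digits n {I} {J} I<J kᴶ≤n same =
      r + b * k ^ I , n′<n , trans (sym (reach-append-digits I r a>0 b>0 same (m%n<n n (k ^ I)))) (cong reach (sym n≡r+a*kᴵ))
      where
      instance
        kᴵ⁺¹≢0 : NonZero (k ^ suc I)
        kᴵ⁺¹≢0 = m^n≢0 k (suc I)
        kᴵk≢0 : NonZero (k ^ I * k)
        kᴵk≢0 = m*n≢0 (k ^ I) k
      a = n / k ^ I
      b = n / k ^ J
      r = n % k ^ I
      a>0 : 0 < a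
      a>0 = m≥n⇒m/n>0 (≤-trans (^-monoʳ-≤ k (<⇒≤ I<J)) kᴶ≤n)
      b>0 : 0 < b
      b>0 = m≥n⇒m/n>0 kᴶ≤n
      b<a : b < a
      b<a = begin-strict
        n / k ^ J            ≤⟨ /-monoʳ-≤ n (^-monoʳ-≤ k I<J) ⟩
        n / k ^ suc I        ≡⟨ /-congʳ (*-comm k (k ^ I)) ⟩
        n / (k ^ I * k)      ≡⟨ m/n/o≡m/[n*o] n (k ^ I) k ⟨
        a / k                <⟨ m/n<m a k {{>-nonZero a>0}} 1<k ⟩
        a                    ∎
        where open ≤-Reasoning
      n≡r+a*kᴵ : n ≡ r + a * k ^ I
      n≡r+a*kᴵ = m≡m%n+[m/n]*n n (k ^ I)
      n′<n : r + b * k ^ I < n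
      n′<n = subst (r + b * k ^ I <_) (sym n≡r+a*kᴵ) (+-monoʳ-< r (*-monoˡ-< (k ^ I) b<a))

    reach-shrink : ∀ n → k ^ size ≤ n → ∃ λ n′ → n′ < n × reach n′ ≡ reach n
    reach-shrink n kˢ≤n =
      let i , j , i<j , same = pigeonhole (n<1+n size) (λ t → encode (reach (_/_ n (k ^ toℕ t) {{m^n≢0 k (toℕ t)}}))) in
      reach-cut-digits n {{m^n≢0 k (toℕ i)}} {{m^n≢0 k (toℕ j)}} i<j (≤-trans (^-monoʳ-≤ k (s≤s⁻¹ (toℕ<n j))) kˢ≤n)
        (trans (sym (decode∘encode _)) (trans (cong decode same) (decode∘encode _)))

  attained? : ∀ {B} {f : ℕ → B} {P : B → Set} → Automaton f → Decidable P → Dec (∃ λ n → P (f n))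
  attained? {f = f} {P} A P? =
    Dec.map′ (λ (i , p) → toℕ i , p) (λ (n , p) → small-witness n p) (any? (λ i → P? (f (toℕ i))))
    where
    open Automaton A
    open Pumping A
    N = k ^ Finite.size finite
    small-witness : ∀ n → P (f n) → ∃ λ (i : Fin N) → P (f (toℕ i))
    small-witness = <-rec _ go
      where
      go : ∀ n → (∀ {m} → m < n → P (f m) → ∃ λ (i : Fin N) → P (f (toℕ i))) → P (f n) → ∃ λ (i : Fin N) → P (f (toℕ i))
      go n ih p with n <? N
      ... | yes n<N = fromℕ< n<N , subst (P ∘ f) (sym (toℕ-fromℕ< n<N)) p
      ... | no  n≮N with n′ , n′<n , same ← reach-shrink n (≮⇒≥ n≮N) =
        ih n′<n (subst P (trans (sym (generates n)) (trans (cong out (sym same)) (generates n′))) p)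

  toDFAO : ∀ {B} {f : ℕ → B} → Automaton f → DFAO k B
  toDFAO A = record
    { nStates = size ; start = encode start ; δ = λ i d → encode (step (decode i) d) ; out = out ∘ decode }
    where
    open Automaton A
    open Finite finite

  run-toDFAO : ∀ {B} {f : ℕ → B} (A : Automaton f) n → run (toDFAO A) (rep k n) ≡ f n
  run-toDFAO A n = trans (cong out (decode-foldl (rep k n) start)) (generates n)
    where
    open Automaton A
    open Finite finite
    decode-foldl : ∀ w q → decode (foldl (λ i d → encode (step (decode i) d)) (encode q) w) ≡ foldl step q w
    decode-foldl []      q = decode∘encode q
    decode-foldl (d ∷ w) q rewrite decode∘encode q = decode-foldl w (step q d)

  preimage-definable : ∀ {B} {g : ℕ → B} {P : B → Set} {E : ℕ → Set} →
                       Automaton g → Decidable P → (∀ n → E n ⇔ P (g n)) → Definable k E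
  preimage-definable {g = g} A P? E⇔P = toDFAO decider , λ n →
      (λ e → trans (run-toDFAO decider n) (dec-true (P? (g n)) (to (E⇔P n) e)))
    , (λ accepted → from (E⇔P n) (dec-true⁻¹ (P? (g n)) (trans (sym (run-toDFAO decider n)) accepted)))
    where
    decider : Automaton (λ n → does (P? (g n)))
    decider = automaton-map (does ∘ P?) A

  module CuttingSetAutomaton {m} (σ : Morphism m) (a : Fin m) (x : ℕ → Fin m)
    (prolongable : Prolongable σ a) (fixed : IsFixedPointFrom σ a x)
    (C : ℕ) (recognizable : RecognizableWith σ x C) (automatic : Automatic k x) where

    Window : Set
    Window = Vec (Fin m) (suc (2 * C))

    -- Entry t is x (n - C + t) when C ≤ n; the form t + n ∸ C makes each entry a shift of x.
    window : ℕ → Window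
    window n = tabulate λ t → x (toℕ t + n ∸ C)

    window-automaton : Automaton window
    window-automaton = automaton-tabulate λ t → automaton-+ (toℕ t) (automaton-∸ C x-automaton)
      where
      x-automaton : Automaton x
      x-automaton = automaton-resp-≗ (proj₂ automatic) (fromDFAO (proj₁ automatic))

    lookup-window : ∀ {n t} → C ≤ n → (t≤2C : t ≤ 2 * C) → Vec.lookup (window n) (fromℕ< (s≤s t≤2C)) ≡ x (n ∸ C + t)
    lookup-window {n} {t} C≤n t≤2C = begin
      Vec.lookup (window n) (fromℕ< (s≤s t≤2C))   ≡⟨ lookup∘tabulate (λ t → x (toℕ t + n ∸ C)) (fromℕ< (s≤s t≤2C)) ⟩
      x (toℕ (fromℕ< (s≤s t≤2C)) + n ∸ C)         ≡⟨ cong (λ e → x (e + n ∸ C)) (toℕ-fromℕ< (s≤s t≤2C)) ⟩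
      x (t + n ∸ C)                               ≡⟨ cong x (+-∸-assoc t C≤n) ⟩
      x (t + (n ∸ C))                             ≡⟨ cong x (+-comm t (n ∸ C)) ⟩
      x (n ∸ C + t)                               ∎
      where open ≡-Reasoning

    window-entries : ∀ {n n′} → C ≤ n → C ≤ n′ → window n ≡ window n′ →
                     ∀ t → t ≤ 2 * C → x (n ∸ C + t) ≡ x (n′ ∸ C + t)
    window-entries {n} {n′} C≤n C≤n′ same-window t t≤2C = begin
      x (n ∸ C + t)                                  ≡⟨ lookup-window C≤n t≤2C ⟨
      Vec.lookup (window n) (fromℕ< (s≤s t≤2C))      ≡⟨ cong (λ w → Vec.lookup w (fromℕ< (s≤s t≤2C))) same-window ⟩
      Vec.lookup (window n′) (fromℕ< (s≤s t≤2C))     ≡⟨ lookup-window C≤n′ t≤2C ⟩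
      x (n′ ∸ C + t)                                 ∎
      where open ≡-Reasoning

    cut-of-window : ∀ n i → C ≤ n → C ≤ cut σ x i → window n ≡ window (cut σ x i) → CuttingSet σ x n
    cut-of-window n i C≤n C≤cutᵢ same-window
      with j , n≡cutⱼ , _ ← proj₂ recognizable n i C≤cutᵢ C≤n (window-entries C≤n C≤cutᵢ same-window) =
      j , sym n≡cutⱼ

    OccursAtCut : Window → Set
    OccursAtCut w = ∃ λ i → C ≤ cut σ x i × window (cut σ x i) ≡ w

    cut⇔occursAtCut : ∀ {n w} → C ≤ n → window n ≡ w → CuttingSet σ x n ⇔ OccursAtCut w
    cut⇔occursAtCut {n} C≤n window-n≡w = mk⇔
      (λ (j , cutⱼ≡n) → j , subst (C ≤_) (sym cutⱼ≡n) C≤n , trans (cong window cutⱼ≡n) window-n≡w)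
      (λ (i , C≤cutᵢ , window-cutᵢ≡w) → cut-of-window n i C≤n C≤cutᵢ (trans window-n≡w (sym window-cutᵢ≡w)))

    profile : ℕ → ℕ × Window
    profile n = n ⊓ C , window n

    profile-automaton : Automaton profile
    profile-automaton = automaton-pair (automaton-⊓ C) window-automaton

    occursAtCut? : ∀ w → Dec (OccursAtCut w)
    occursAtCut? w with attained? profile-automaton (λ (c , v) → (C ≤? c) ×-dec ≡-dec _≟ᶠ_ v w)
    ... | yes (n , C≤n⊓C , window-n≡w) =
      Dec.map (cut⇔occursAtCut C≤n window-n≡w) (cuttingSet? prolongable fixed n)
      where C≤n = ≤-trans C≤n⊓C (m⊓n≤m n C)
    ... | no never = no λ (i , C≤cutᵢ , window-cutᵢ≡w) → never (cut σ x i , ⊓-glb C≤cutᵢ ≤-refl , window-cutᵢ≡w)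

    CutProfile : ℕ × Window → Set
    CutProfile (c , w) = (c < C × CuttingSet σ x c) ⊎ (C ≤ c × OccursAtCut w)

    cutProfile? : Decidable CutProfile
    cutProfile? (c , w) = ((c <? C) ×-dec cuttingSet? prolongable fixed c) ⊎-dec ((C ≤? c) ×-dec occursAtCut? w)

    cuttingSet⇔cutProfile : ∀ n → CuttingSet σ x n ⇔ CutProfile (profile n)
    cuttingSet⇔cutProfile n with C ≤? n
    ... | yes C≤n rewrite m≥n⇒m⊓n≡n C≤n = mk⇔
      (λ cs → inj₂ (≤-refl , to (cut⇔occursAtCut C≤n refl) cs))
      λ { (inj₁ (C<C , _))   → ⊥-elim (<-irrefl refl C<C)
        ; (inj₂ (_ , occurs)) → from (cut⇔occursAtCut C≤n refl) occurs }
    ... | no C≰n rewrite m≤n⇒m⊓n≡m (<⇒≤ (≰⇒> C≰n)) = mk⇔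
      (λ cs → inj₁ (≰⇒> C≰n , cs))
      λ { (inj₁ (_ , cs))   → cs
        ; (inj₂ (C≤n , _)) → ⊥-elim (C≰n C≤n) }

theorem15 : (m : ℕ) (σ : Morphism m) (a : Fin m) (x : ℕ → Fin m)
    (k : ℕ) .{{_ : NonZero k}} → 1 < k →
    Prolongable σ a → IsFixedPointFrom σ a x →
    Σ ℕ (λ C → RecognizableWith σ x C) →
    Automatic k x →
    Definable k (CuttingSet σ x)
theorem15 m σ a x (suc (suc k′)) (s≤s (s≤s z≤n)) prolongable fixed (C , recognizable) automatic =
  preimage-definable k′ profile-automaton cutProfile? cuttingSet⇔cutProfile
  where open CuttingSetAutomaton k′ σ a x prolongable fixed C recognizable automatic
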